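{- Let $s>5$ be a square-free integer with $5\nmid s$ and $s\equiv 1\pmod 4$, and let $K=\mathbb{Q}(\sqrt{5},\sqrt{s})$. Then $\mathcal{P}(\mathcal{O}_K)\geq 5$. In particular, the element \[\alpha = 1^2+1^2+\Bigl(\frac{1+\sqrt5}{2}\Bigr)^2+\Bigl(\frac{1+\sqrt{s}}{2}\Bigr)^2+\Bigl(\frac{ -\sqrt5+\sqrt{s}}{2}\Bigr)^2\] has length $5$ in $\mathcal{O}_K$.
   Context: $\mathcal{O}_K$ is the ring of integers of $K$. For a commutative ring $R$, let $\sum R^2$ be the set of finite sums of squares of elements of $R$; for $\alpha\in\sum R^2$ its length $\ell(\alpha)$ is the least $n$ such that $\alpha$ is a sum of $n$ squares in $R$, and the Pythagoras number is $\mathcal{P}(R)=\sup\{\ell(\alpha):\alpha\in\sum R^2\}$. -}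

module Defs where

open import Data.Nat as ℕ using (ℕ)
open import Data.Nat.DivMod using (_/_; _%_)
open import Data.Nat.Divisibility using (_∣_)
open import Data.Integer using (ℤ; +_; _+_; _*_; -_; 0ℤ; 1ℤ)
open import Data.Fin using (Fin; zero; suc)
open import Data.Product using (Σ; _×_)
open import Relation.Binary.PropositionalEquality using (_≡_)
open import Relation.Nullary using (¬_)

SquareFree : ℕ → Set
SquareFree s = ∀ (d : ℕ) → (d ℕ.* d) ∣ s → d ≡ 1

-- ℤ[φ] with φ = (1+√5)/2, φ² = φ + 1.  Element  re + im·φ.
record Zφ : Set where
  constructor _+φ_
  field
    re im : ℤ
open Zφ public

infixl 6 _⊕_
infixl 7 _⊗_ _·φ_

_⊕_ : Zφ → Zφ → Zφ
(a +φ b) ⊕ (c +φ d) = (a + c) +φ (b + d)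

_⊗_ : Zφ → Zφ → Zφ
(a +φ b) ⊗ (c +φ d) = (a * c + b * d) +φ (a * d + b * c + b * d)

_·φ_ : ℤ → Zφ → Zφ
k ·φ (a +φ b) = (k * a) +φ (k * b)

-- The ring of integers of K = ℚ(√5,√s) for s ≡ 1 (mod 4), gcd(5,s)=1:
-- O_K = ℤ[φ][ω], ω = (1+√s)/2, ω² = ω + t with t = (s-1)/4.
-- Element  fst + snd·ω  with fst, snd ∈ ℤ[φ]; i.e. ℤ-basis 1, φ, ω, φω.
record OK (t : ℤ) : Set where
  constructor _+ω_
  field
    fst snd : Zφ
open OK public

module _ {t : ℤ} where
  infixl 6 _+ₒ_
  infixl 7 _*ₒ_
  _+ₒ_ : OK t → OK t → OK t
  (p +ω q) +ₒ (p' +ω q') = (p ⊕ p') +ω (q ⊕ q')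

  _*ₒ_ : OK t → OK t → OK t
  (p +ω q) *ₒ (p' +ω q') =
    (p ⊗ p' ⊕ t ·φ (q ⊗ q')) +ω (p ⊗ q' ⊕ q ⊗ p' ⊕ q ⊗ q')

  0ₒ 1ₒ φₒ ωₒ : OK t
  0ₒ = (0ℤ +φ 0ℤ) +ω (0ℤ +φ 0ℤ)
  1ₒ = (1ℤ +φ 0ℤ) +ω (0ℤ +φ 0ℤ)
  φₒ = (0ℤ +φ 1ℤ) +ω (0ℤ +φ 0ℤ)
  ωₒ = (0ℤ +φ 0ℤ) +ω (1ℤ +φ 0ℤ)

  -ₒ_ : OK t → OK t
  -ₒ ((a +φ b) +ω (c +φ d)) = ((- a) +φ (- b)) +ω ((- c) +φ (- d))

  sq : OK t → OK t
  sq x = x *ₒ x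

  sumSq : (n : ℕ) → (Fin n → OK t) → OK t
  sumSq ℕ.zero    v = 0ₒ
  sumSq (ℕ.suc n) v = sq (v zero) +ₒ sumSq n (λ i → v (suc i))

  IsSumOfSquares : ℕ → OK t → Set
  IsSumOfSquares n x = Σ (Fin n → OK t) λ v → sumSq n v ≡ x

  HasLength : OK t → ℕ → Set
  HasLength x n = IsSumOfSquares n x × (∀ m → m ℕ.< n → ¬ IsSumOfSquares m x)

  PythagorasAtLeast : ℕ → Set
  PythagorasAtLeast n =
    Σ (OK t) λ x → Σ ℕ (λ k → IsSumOfSquares k x) × (∀ m → m ℕ.< n → ¬ IsSumOfSquares m x)

-- t = (s-1)/4 for s ≡ 1 mod 4
tOf : ℕ → ℤ
tOf s = + (s / 4)

-- α = 1² + 1² + φ² + ω² + (ω - φ)²,  since (-√5+√s)/2 = ω - φ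
α : (s : ℕ) → OK (tOf s)
α s = sq 1ₒ +ₒ sq 1ₒ +ₒ sq φₒ +ₒ sq ωₒ +ₒ sq (ωₒ +ₒ (-ₒ φₒ))

{-# OPTIONS --safe #-}
module Submission where

-- Write x ∈ O_K as p + qω with p, q ∈ ℤ[φ].  As ω² = ω + t, a sum of squares Σ xᵢ² depends
-- only on the Gram data P = Σ pᵢ², Q = Σ qᵢ², X = Σ pᵢqᵢ, namely Σ xᵢ² = (P + tQ) + (2X + Q)ω.
-- The five squares defining α have P = 4 + 2φ, Q = 2, X = −φ.  If α = Σ xᵢ² for another family,
-- comparing coordinates expresses P and Q through X; as sums of squares are nonnegative at
-- φ = 0 and at φ = 4/3 (both between the conjugates of φ) and t = (s − 1)/4 ≥ 3, only X = −φ
-- survives, so the family has the Gram data of α.  Modulo 4 these Gram data depend only on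
-- p and q modulo 2, and running through all parity patterns shows that four summands never fit.

open import Defs
open import Data.Nat using (ℕ; _<_)
open import Data.Nat.DivMod using (_%_)
open import Data.Nat.Divisibility using (_∣_)
open import Data.Product using (_×_)
open import Relation.Binary.PropositionalEquality using (_≡_)
open import Relation.Nullary using (¬_)

open import Level using (0ℓ)
import Data.Nat as ℕ
import Data.Nat.Properties as ℕ
open import Data.Nat.DivMod using (m≡m%n+[m/n]*n)
open import Data.Nat.Divisibility using (divides)
open import Data.Integer as ℤ using (ℤ; +_; -[1+_]; 0ℤ; 1ℤ; -1ℤ; _+_; _*_; _-_; -_; _≤_; +≤+)
import Data.Integer.Properties as ℤ
open import Data.Integer.DivMod using (a≡a%n+[a/n]*n; n%d<d)
open import Data.Integer.Divisibility.Signed as Signed using (_∣?_) renaming (_∣_ to _ℤ∣_)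
open import Data.Integer.Tactic.RingSolver using (solve-∀)
open import Algebra.Properties.Semiring.Sum ℤ.+-*-semiring
  using (sum; ∑-distrib-+; *-distribˡ-sum; sum-cong-≗)
open import Data.Bool using (Bool; true; false)
open import Data.Empty using (⊥-elim)
open import Data.Fin using (Fin; zero; suc)
open import Data.Product using (_,_; proj₁; proj₂)
open import Data.Vec using (Vec; []; _∷_; lookup; tabulate)
open import Data.Vec.Properties using (lookup∘tabulate)
open import Function using (_∘_; id)
open import Relation.Binary.PropositionalEquality
  using (refl; sym; trans; cong; cong₂; subst; module ≡-Reasoning)
open import Relation.Nullary using (Dec; contradiction)
open import Relation.Nullary.Decidable using (map′; _×-dec_; _→-dec_; ¬?; from-yes)
open import Relation.Unary using (Pred; Decidable)

-- Gram data of a family in O_K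

Zφ-≡ : ∀ {u w : Zφ} → re u ≡ re w → im u ≡ im w → u ≡ w
Zφ-≡ = cong₂ _+φ_

OK-≡ : ∀ {t} {x y : OK t} → fst x ≡ fst y → snd x ≡ snd y → x ≡ y
OK-≡ = cong₂ _+ω_

∑φ : ∀ {n} → (Fin n → Zφ) → Zφ
∑φ f = sum (re ∘ f) +φ sum (im ∘ f)

∑φ-cong : ∀ {n} {f g : Fin n → Zφ} → (∀ i → f i ≡ g i) → ∑φ f ≡ ∑φ g
∑φ-cong f≗g = Zφ-≡ (sum-cong-≗ (cong re ∘ f≗g)) (sum-cong-≗ (cong im ∘ f≗g))

∑φ-⊕ : ∀ {n} (f g : Fin n → Zφ) → ∑φ (λ i → f i ⊕ g i) ≡ ∑φ f ⊕ ∑φ g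
∑φ-⊕ f g = Zφ-≡ (∑-distrib-+ (re ∘ f) (re ∘ g)) (∑-distrib-+ (im ∘ f) (im ∘ g))

∑φ-·φ : ∀ {n} k (f : Fin n → Zφ) → ∑φ (λ i → k ·φ f i) ≡ k ·φ ∑φ f
∑φ-·φ k f = Zφ-≡ (sym (*-distribˡ-sum k (re ∘ f))) (sym (*-distribˡ-sum k (im ∘ f)))

⟨_,_⟩ : ∀ {n} → (Fin n → Zφ) → (Fin n → Zφ) → Zφ
⟨ u , w ⟩ = ∑φ (λ i → u i ⊗ w i)

Gram : Set
Gram = Zφ × Zφ × Zφ

module _ {t : ℤ} where

  gram : ∀ {n} → (Fin n → OK t) → Gram
  gram v = ⟨ fst ∘ v , fst ∘ v ⟩ , ⟨ snd ∘ v , snd ∘ v ⟩ , ⟨ fst ∘ v , snd ∘ v ⟩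

  fromGram : Gram → OK t
  fromGram (P , Q , X) = (P ⊕ t ·φ Q) +ω (+ 2 ·φ X ⊕ Q)

  sumSq-∑φ : ∀ n (v : Fin n → OK t) → sumSq n v ≡ ∑φ (fst ∘ sq ∘ v) +ω ∑φ (snd ∘ sq ∘ v)
  sumSq-∑φ ℕ.zero    v = refl
  sumSq-∑φ (ℕ.suc n) v = cong (sq (v zero) +ₒ_) (sumSq-∑φ n (v ∘ suc))

  snd-sq : ∀ (x : OK t) → snd (sq x) ≡ + 2 ·φ (fst x ⊗ snd x) ⊕ snd x ⊗ snd x
  snd-sq ((a +φ b) +ω (c +φ d)) = Zφ-≡ (re-part a b c d) (im-part a b c d)
    where
    re-part : ∀ a b c d → (a * c + b * d) + (c * a + d * b) + (c * c + d * d)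
                        ≡ + 2 * (a * c + b * d) + (c * c + d * d)
    re-part = solve-∀
    im-part : ∀ a b c d → (a * d + b * c + b * d) + (c * b + d * a + d * b) + (c * d + d * c + d * d)
                        ≡ + 2 * (a * d + b * c + b * d) + (c * d + d * c + d * d)
    im-part = solve-∀

  sumSq-fromGram : ∀ {n} (v : Fin n → OK t) → sumSq n v ≡ fromGram (gram v)
  sumSq-fromGram {n} v = trans (sumSq-∑φ n v) (OK-≡ fst-part snd-part)
    where
    p q : Fin n → Zφ
    p = fst ∘ v
    q = snd ∘ v
    fst-part : ∑φ (fst ∘ sq ∘ v) ≡ ⟨ p , p ⟩ ⊕ t ·φ ⟨ q , q ⟩
    fst-part = trans (∑φ-⊕ (λ i → p i ⊗ p i) (λ i → t ·φ (q i ⊗ q i)))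
                     (cong (⟨ p , p ⟩ ⊕_) (∑φ-·φ t (λ i → q i ⊗ q i)))
    snd-part : ∑φ (snd ∘ sq ∘ v) ≡ + 2 ·φ ⟨ p , q ⟩ ⊕ ⟨ q , q ⟩
    snd-part = trans (∑φ-cong (snd-sq ∘ v))
                     (trans (∑φ-⊕ (λ i → + 2 ·φ (p i ⊗ q i)) (λ i → q i ⊗ q i))
                            (cong (_⊕ ⟨ q , q ⟩) (∑φ-·φ (+ 2) (λ i → p i ⊗ q i))))

-- Positivity of sums of squares in ℤ[φ]

0≤i+j : ∀ {i j} → 0ℤ ≤ i → 0ℤ ≤ j → 0ℤ ≤ i + j
0≤i+j = ℤ.+-mono-≤

0≤i*j : ∀ {i j} → 0ℤ ≤ i → 0ℤ ≤ j → 0ℤ ≤ i * j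
0≤i*j (+≤+ {n = m} _) (+≤+ {n = n} _) = subst (0ℤ ≤_) (ℤ.pos-* m n) (+≤+ ℕ.z≤n)

0≤i*i : ∀ i → 0ℤ ≤ i * i
0≤i*i (+ n)    = 0≤i*j {+ n} {+ n} (+≤+ ℕ.z≤n) (+≤+ ℕ.z≤n)
0≤i*i -[1+ n ] = +≤+ ℕ.z≤n

0≤sum : ∀ {n} (f : Fin n → ℤ) → (∀ i → 0ℤ ≤ f i) → 0ℤ ≤ sum f
0≤sum {ℕ.zero}  f 0≤f = +≤+ ℕ.z≤n
0≤sum {ℕ.suc n} f 0≤f = 0≤i+j (0≤f zero) (0≤sum (f ∘ suc) (0≤f ∘ suc))

-- Nine times the value of a + bφ at φ = 4/3.  Squares are nonnegative there,
-- since 4/3 lies between the two roots of φ² = φ + 1.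
at4/3 : Zφ → ℤ
at4/3 (a +φ b) = + 9 * a + + 12 * b

at4/3-∑φ : ∀ {n} (f : Fin n → Zφ) → at4/3 (∑φ f) ≡ sum (at4/3 ∘ f)
at4/3-∑φ f = trans (cong₂ _+_ (*-distribˡ-sum (+ 9) (re ∘ f)) (*-distribˡ-sum (+ 12) (im ∘ f)))
                   (sym (∑-distrib-+ (λ i → + 9 * re (f i)) (λ i → + 12 * im (f i))))

0≤re[u⊗u] : ∀ u → 0ℤ ≤ re (u ⊗ u)
0≤re[u⊗u] (a +φ b) = 0≤i+j (0≤i*i a) (0≤i*i b)

0≤at4/3[u⊗u] : ∀ u → 0ℤ ≤ at4/3 (u ⊗ u)
0≤at4/3[u⊗u] (a +φ b) =
  subst (0ℤ ≤_) (sym (sum-of-squares a b))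
        (0≤i+j (0≤i*i (+ 3 * a + + 4 * b)) (0≤i*j {+ 5} (+≤+ ℕ.z≤n) (0≤i*i b)))
  where
  sum-of-squares : ∀ a b → + 9 * (a * a + b * b) + + 12 * (a * b + b * a + b * b)
                         ≡ (+ 3 * a + + 4 * b) * (+ 3 * a + + 4 * b) + + 5 * (b * b)
  sum-of-squares = solve-∀

0≤re⟨u,u⟩ : ∀ {n} (u : Fin n → Zφ) → 0ℤ ≤ re ⟨ u , u ⟩
0≤re⟨u,u⟩ u = 0≤sum _ (0≤re[u⊗u] ∘ u)

0≤at4/3⟨u,u⟩ : ∀ {n} (u : Fin n → Zφ) → 0ℤ ≤ at4/3 ⟨ u , u ⟩
0≤at4/3⟨u,u⟩ u = subst (0ℤ ≤_) (sym (at4/3-∑φ (λ i → u i ⊗ u i))) (0≤sum _ (0≤at4/3[u⊗u] ∘ u))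

⊗-expand : ∀ c u w →
           (u ⊕ c ·φ w) ⊗ (u ⊕ c ·φ w) ≡ u ⊗ u ⊕ (+ 2 * c) ·φ (u ⊗ w) ⊕ (c * c) ·φ (w ⊗ w)
⊗-expand c (a +φ b) (d +φ e) = Zφ-≡ (re-part c a b d e) (im-part c a b d e)
  where
  re-part : ∀ c a b d e → (a + c * d) * (a + c * d) + (b + c * e) * (b + c * e)
                        ≡ (a * a + b * b) + (+ 2 * c) * (a * d + b * e) + (c * c) * (d * d + e * e)
  re-part = solve-∀
  im-part : ∀ c a b d e → (a + c * d) * (b + c * e) + (b + c * e) * (a + c * d) + (b + c * e) * (b + c * e)
                        ≡ (a * b + b * a + b * b) + (+ 2 * c) * (a * e + b * d + b * e)
                          + (c * c) * (d * e + e * d + e * e)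
  im-part = solve-∀

⟨⟩-expand : ∀ {n} c (u w : Fin n → Zφ) →
            ⟨ (λ i → u i ⊕ c ·φ w i) , (λ i → u i ⊕ c ·φ w i) ⟩
            ≡ ⟨ u , u ⟩ ⊕ (+ 2 * c) ·φ ⟨ u , w ⟩ ⊕ (c * c) ·φ ⟨ w , w ⟩
⟨⟩-expand {n} c u w = begin
  ∑φ (λ i → (u i ⊕ c ·φ w i) ⊗ (u i ⊕ c ·φ w i))
    ≡⟨ ∑φ-cong (λ i → ⊗-expand c (u i) (w i)) ⟩
  ∑φ (λ i → uu i ⊕ (+ 2 * c) ·φ uw i ⊕ (c * c) ·φ ww i)
    ≡⟨ ∑φ-⊕ (λ i → uu i ⊕ (+ 2 * c) ·φ uw i) (λ i → (c * c) ·φ ww i) ⟩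
  ∑φ (λ i → uu i ⊕ (+ 2 * c) ·φ uw i) ⊕ ∑φ (λ i → (c * c) ·φ ww i)
    ≡⟨ cong₂ _⊕_ (trans (∑φ-⊕ uu (λ i → (+ 2 * c) ·φ uw i))
                        (cong (∑φ uu ⊕_) (∑φ-·φ (+ 2 * c) uw)))
                 (∑φ-·φ (c * c) ww) ⟩
  ⟨ u , u ⟩ ⊕ (+ 2 * c) ·φ ⟨ u , w ⟩ ⊕ (c * c) ·φ ⟨ w , w ⟩ ∎
  where
  open ≡-Reasoning
  uu uw ww : Fin n → Zφ
  uu i = u i ⊗ u i
  uw i = u i ⊗ w i
  ww i = w i ⊗ w i

0≤re-quadratic : ∀ {n} c (u w : Fin n → Zφ) →
                 0ℤ ≤ re ⟨ u , u ⟩ + + 2 * c * re ⟨ u , w ⟩ + c * c * re ⟨ w , w ⟩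
0≤re-quadratic c u w =
  subst (0ℤ ≤_) (cong re (⟨⟩-expand c u w)) (0≤re⟨u,u⟩ (λ i → u i ⊕ c ·φ w i))

-- The Gram data of α are forced

a+b≡c⇒b≡c-a : ∀ {a b c} → a + b ≡ c → b ≡ c - a
a+b≡c⇒b≡c-a {a} {b} refl = identity a b
  where
  identity : ∀ a b → b ≡ a + b - a
  identity = solve-∀

a+b≡c⇒a≡c-b : ∀ {a b c} → a + b ≡ c → a ≡ c - b
a+b≡c⇒a≡c-b {a} {b} refl = identity a b
  where
  identity : ∀ a b → a ≡ a + b - b
  identity = solve-∀

0≰-[1+n] : ∀ {i n} → i ≡ -[1+ n ] → ¬ (0ℤ ≤ i)
0≰-[1+n] refl ()

-- Each excluded case is refuted by a certificate: a sum of nonnegative terms that is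
-- identically a negative constant.  For X = 1 it is re ⟨p + cq, p + cq⟩ with c = −(t + 3),
-- which is −2 because then Q = 0.
module _ {t : ℤ} (3≤t : + 3 ≤ t) where

  private
    0≤t : 0ℤ ≤ t
    0≤t = ℤ.≤-trans (+≤+ ℕ.z≤n) 3≤t

    0≤t-3 : 0ℤ ≤ t - + 3
    0≤t-3 = ℤ.i≤j⇒0≤j-i 3≤t

  re-gram-forced : ∀ {P Q X} → Q ≡ + 2 - + 2 * X → P ≡ + 4 + t * + 2 - t * Q →
                   0ℤ ≤ P → 0ℤ ≤ Q → 0ℤ ≤ P + + 2 * - (t + + 3) * X + - (t + + 3) * - (t + + 3) * Q →
                   P ≡ + 4 × Q ≡ + 2 × X ≡ 0ℤ
  re-gram-forced {X = -[1+ n ]} refl refl 0≤P _ _ =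
    ⊥-elim (0≰-[1+n] (certificate t -[1+ n ])
      (0≤i+j 0≤P (0≤i*j {+ 2} (+≤+ ℕ.z≤n) (0≤i+j (0≤i*j {+ n} (+≤+ ℕ.z≤n) 0≤t) 0≤t-3))))
    where
    certificate : ∀ t X → (+ 4 + t * + 2 - t * (+ 2 - + 2 * X)) + + 2 * ((- + 1 - X) * t + (t - + 3))
                        ≡ - + 2
    certificate = solve-∀
  re-gram-forced {X = + 0} refl refl _ _ _ = P≡4 t , refl , refl
    where
    P≡4 : ∀ t → + 4 + t * + 2 - t * (+ 2 - + 2 * 0ℤ) ≡ + 4
    P≡4 = solve-∀
  re-gram-forced {X = + 1} refl refl _ _ 0≤quadratic = ⊥-elim (0≰-[1+n] (certificate t) 0≤quadratic)
    where
    certificate : ∀ t → (+ 4 + t * + 2 - t * (+ 2 - + 2 * + 1)) + + 2 * - (t + + 3) * + 1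
                        + - (t + + 3) * - (t + + 3) * (+ 2 - + 2 * + 1) ≡ - + 2
    certificate = solve-∀
  re-gram-forced {X = + ℕ.suc (ℕ.suc n)} refl refl _ 0≤Q _ =
    ⊥-elim (0≰-[1+n] (certificate (+ n))
      (0≤i+j 0≤Q (0≤i*j {+ 2} {+ n} (+≤+ ℕ.z≤n) (+≤+ ℕ.z≤n))))
    where
    certificate : ∀ N → (+ 2 - + 2 * (+ 2 + N)) + + 2 * N ≡ - + 2
    certificate = solve-∀

  im-gram-forced : ∀ {P Q Y} → Q ≡ - + 2 - + 2 * Y → P ≡ + 2 + t * 0ℤ - t * Q →
                   0ℤ ≤ + 9 * + 4 + + 12 * P → 0ℤ ≤ + 9 * + 2 + + 12 * Q →
                   P ≡ + 2 × Q ≡ 0ℤ × Y ≡ -1ℤ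
  im-gram-forced {Y = + n} refl refl _ 0≤Q =
    ⊥-elim (0≰-[1+n] (certificate (+ n))
      (0≤i+j 0≤Q (0≤i*j {+ 24} {+ n} (+≤+ ℕ.z≤n) (+≤+ ℕ.z≤n))))
    where
    certificate : ∀ Y → (+ 9 * + 2 + + 12 * (- + 2 - + 2 * Y)) + + 24 * Y ≡ - + 6
    certificate = solve-∀
  im-gram-forced {Y = -[1+ 0 ]} refl refl _ _ = P≡2 t , refl , refl
    where
    P≡2 : ∀ t → + 2 + t * 0ℤ - t * (- + 2 - + 2 * - + 1) ≡ + 2
    P≡2 = solve-∀
  im-gram-forced {Y = -[1+ ℕ.suc n ]} refl refl 0≤P _ =
    ⊥-elim (0≰-[1+n] (certificate t -[1+ ℕ.suc n ])
      (0≤i+j 0≤P (0≤i*j {+ 24} (+≤+ ℕ.z≤n) (0≤i+j (0≤i*j {+ n} (+≤+ ℕ.z≤n) 0≤t) 0≤t-3))))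
    where
    certificate : ∀ t Y → (+ 9 * + 4 + + 12 * (+ 2 + t * 0ℤ - t * (- + 2 - + 2 * Y)))
                          + + 24 * ((- + 2 - Y) * t + (t - + 3)) ≡ - + 12
    certificate = solve-∀

α₅ : ∀ {t} → Fin 5 → OK t
α₅ = lookup (1ₒ ∷ 1ₒ ∷ φₒ ∷ ωₒ ∷ (ωₒ +ₒ (-ₒ φₒ)) ∷ [])

gram-forced : ∀ {t n} → + 3 ≤ t → (v : Fin n → OK t) →
              sumSq n v ≡ sumSq 5 α₅ → gram v ≡ gram (α₅ {t})
gram-forced {t} {n} 3≤t v Σv²≡Σα₅² =
  let P≡4 , Q≡2 , X≡0 =
        re-gram-forced 3≤t (a+b≡c⇒b≡c-a {+ 2 * re X} (cong (λ x → re (snd x)) coords))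
                           (a+b≡c⇒a≡c-b {re P} (cong (λ x → re (fst x)) coords))
                           (0≤re⟨u,u⟩ p) (0≤re⟨u,u⟩ q) (0≤re-quadratic (- (t + + 3)) p q)
      P≡2 , Q≡0 , X≡-1 =
        im-gram-forced 3≤t (a+b≡c⇒b≡c-a {+ 2 * im X} (cong (λ x → im (snd x)) coords))
                           (a+b≡c⇒a≡c-b {im P} (cong (λ x → im (fst x)) coords))
                           (subst (λ a → 0ℤ ≤ + 9 * a + + 12 * im P) P≡4 (0≤at4/3⟨u,u⟩ p))
                           (subst (λ a → 0ℤ ≤ + 9 * a + + 12 * im Q) Q≡2 (0≤at4/3⟨u,u⟩ q))
  in cong₂ _,_ (Zφ-≡ P≡4 P≡2) (cong₂ _,_ (Zφ-≡ Q≡2 Q≡0) (Zφ-≡ X≡0 X≡-1))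
  where
  p q : Fin n → Zφ
  p = fst ∘ v
  q = snd ∘ v
  P Q X : Zφ
  P = ⟨ p , p ⟩
  Q = ⟨ q , q ⟩
  X = ⟨ p , q ⟩
  coords : fromGram (gram v) ≡ fromGram (gram (α₅ {t}))
  coords = trans (sym (sumSq-fromGram v)) (trans Σv²≡Σα₅² (sumSq-fromGram α₅))

-- Gram data modulo 4 and the parity check

infix 4 _≡_mod_ _≡φ_mod_ _≡?_mod_ _≡φ?_mod_

record _≡_mod_ (a b n : ℤ) : Set where
  constructor multiple
  field
    quotient : ℤ
    equation : a ≡ b + quotient * n

record _≡φ_mod_ (u w : Zφ) (n : ℤ) : Set where
  constructor componentwise
  field
    re-cong : re u ≡ re w mod n
    im-cong : im u ≡ im w mod n
open _≡φ_mod_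

_≡?_mod_ : ∀ a b n → Dec (a ≡ b mod n)
a ≡? b mod n = map′ from-∣ to-∣ (n ∣? a - b)
  where
  from-∣ : n ℤ∣ a - b → a ≡ b mod n
  from-∣ (Signed.divides k a-b≡kn) = multiple k (trans (identity a b) (cong (_+_ b) a-b≡kn))
    where
    identity : ∀ a b → a ≡ b + (a - b)
    identity = solve-∀
  to-∣ : a ≡ b mod n → n ℤ∣ a - b
  to-∣ (multiple k refl) = Signed.divides k (identity b k n)
    where
    identity : ∀ b k n → b + k * n - b ≡ k * n
    identity = solve-∀

_≡φ?_mod_ : ∀ u w n → Dec (u ≡φ w mod n)
u ≡φ? w mod n = map′ (λ (r , i) → componentwise r i) (λ (componentwise r i) → r , i)
                     ((re u ≡? re w mod n) ×-dec (im u ≡? im w mod n))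

+-cong[mod] : ∀ {a a′ b b′ n} → a ≡ a′ mod n → b ≡ b′ mod n → a + b ≡ a′ + b′ mod n
+-cong[mod] {a′ = a′} {b′ = b′} {n} (multiple k refl) (multiple l refl) =
  multiple (k + l) (identity a′ b′ k l n)
  where
  identity : ∀ a′ b′ k l n → a′ + k * n + (b′ + l * n) ≡ a′ + b′ + (k + l) * n
  identity = solve-∀

*-cong[mod] : ∀ {a a′ b b′ n} → a ≡ a′ mod n → b ≡ b′ mod n → a * b ≡ a′ * b′ mod n
*-cong[mod] {a′ = a′} {b′ = b′} {n} (multiple k refl) (multiple l refl) =
  multiple (k * b′ + a′ * l + k * l * n) (identity a′ b′ k l n)
  where
  identity : ∀ a′ b′ k l n → (a′ + k * n) * (b′ + l * n)
                           ≡ a′ * b′ + (k * b′ + a′ * l + k * l * n) * n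
  identity = solve-∀

*-scale[mod] : ∀ {a a′ n} c → a ≡ a′ mod n → c * a ≡ c * a′ mod c * n
*-scale[mod] {a′ = a′} {n} c (multiple k refl) = multiple k (identity c a′ k n)
  where
  identity : ∀ c a′ k n → c * (a′ + k * n) ≡ c * a′ + k * (c * n)
  identity = solve-∀

square-cong[mod] : ∀ {a a′} → a ≡ a′ mod + 2 → a * a ≡ a′ * a′ mod + 4
square-cong[mod] {a′ = a′} (multiple k refl) = multiple (k * a′ + k * k) (identity a′ k)
  where
  identity : ∀ a′ k → (a′ + k * + 2) * (a′ + k * + 2) ≡ a′ * a′ + (k * a′ + k * k) * + 4
  identity = solve-∀

symmetric-product-cong[mod] : ∀ {a a′ b b′} → a ≡ a′ mod + 2 → b ≡ b′ mod + 2 →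
                              a * b + b * a ≡ a′ * b′ + b′ * a′ mod + 4
symmetric-product-cong[mod] {a′ = a′} {b′ = b′} (multiple k refl) (multiple l refl) =
  multiple (a′ * l + k * b′ + + 2 * k * l) (identity a′ b′ k l)
  where
  identity : ∀ a′ b′ k l → (a′ + k * + 2) * (b′ + l * + 2) + (b′ + l * + 2) * (a′ + k * + 2)
                         ≡ a′ * b′ + b′ * a′ + (a′ * l + k * b′ + + 2 * k * l) * + 4
  identity = solve-∀

sum-cong[mod] : ∀ {m n} {f g : Fin m → ℤ} → (∀ i → f i ≡ g i mod n) → sum f ≡ sum g mod n
sum-cong[mod] {ℕ.zero}  f≡g = multiple 0ℤ refl
sum-cong[mod] {ℕ.suc m} f≡g = +-cong[mod] (f≡g zero) (sum-cong[mod] (f≡g ∘ suc))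

⟨⟩-cong[mod] : ∀ {m n} {u u′ w w′ : Fin m → Zφ} → (∀ i → u i ≡φ u′ i mod n) →
               (∀ i → w i ≡φ w′ i mod n) → ⟨ u , w ⟩ ≡φ ⟨ u′ , w′ ⟩ mod n
⟨⟩-cong[mod] u≡u′ w≡w′ = componentwise
  (sum-cong[mod] λ i → +-cong[mod] (*-cong[mod] (re-cong (u≡u′ i)) (re-cong (w≡w′ i)))
                                   (*-cong[mod] (im-cong (u≡u′ i)) (im-cong (w≡w′ i))))
  (sum-cong[mod] λ i → +-cong[mod] (+-cong[mod] (*-cong[mod] (re-cong (u≡u′ i)) (im-cong (w≡w′ i)))
                                                (*-cong[mod] (im-cong (u≡u′ i)) (re-cong (w≡w′ i))))
                                   (*-cong[mod] (im-cong (u≡u′ i)) (im-cong (w≡w′ i))))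

⟨u,u⟩-cong[mod4] : ∀ {m} {u u′ : Fin m → Zφ} →
                   (∀ i → u i ≡φ u′ i mod + 2) → ⟨ u , u ⟩ ≡φ ⟨ u′ , u′ ⟩ mod + 4
⟨u,u⟩-cong[mod4] u≡u′ = componentwise
  (sum-cong[mod] λ i → +-cong[mod] (square-cong[mod] (re-cong (u≡u′ i)))
                                   (square-cong[mod] (im-cong (u≡u′ i))))
  (sum-cong[mod] λ i → +-cong[mod] (symmetric-product-cong[mod] (re-cong (u≡u′ i)) (im-cong (u≡u′ i)))
                                   (square-cong[mod] (im-cong (u≡u′ i))))

·φ-scale[mod] : ∀ {u u′ n} c → u ≡φ u′ mod n → c ·φ u ≡φ c ·φ u′ mod c * n
·φ-scale[mod] c (componentwise re≡ im≡) = componentwise (*-scale[mod] c re≡) (*-scale[mod] c im≡)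

bit : Bool → ℤ
bit false = 0ℤ
bit true  = 1ℤ

parity : ℤ → Bool
parity a = a ℤ.% + 2 ℕ.≡ᵇ 1

a≡bit[parity[a]] : ∀ a → a ≡ bit (parity a) mod + 2
a≡bit[parity[a]] a = multiple (a ℤ./ + 2)
  (trans (a≡a%n+[a/n]*n a (+ 2)) (cong (λ r → r + a ℤ./ + 2 * + 2) (bit-of (a ℤ.% + 2) (n%d<d a (+ 2)))))
  where
  bit-of : ∀ r → r ℕ.< 2 → + r ≡ bit (r ℕ.≡ᵇ 1)
  bit-of 0 _ = refl
  bit-of 1 _ = refl
  bit-of (ℕ.suc (ℕ.suc _)) (ℕ.s≤s (ℕ.s≤s ()))

Parity : Set
Parity = Vec Bool 2

reduce : Zφ → Parity
reduce (a +φ b) = parity a ∷ parity b ∷ []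

embed : Parity → Zφ
embed (x ∷ y ∷ []) = bit x +φ bit y

u≡embed[reduce[u]] : ∀ u → u ≡φ embed (reduce u) mod + 2
u≡embed[reduce[u]] (a +φ b) = componentwise (a≡bit[parity[a]] a) (a≡bit[parity[a]] b)

lift : ∀ {n} → Vec Parity n → Fin n → Zφ
lift ps = embed ∘ lookup ps

u≡lift[reduce[u]] : ∀ {n} (u : Fin n → Zφ) i → u i ≡φ lift (tabulate (reduce ∘ u)) i mod + 2
u≡lift[reduce[u]] u i =
  subst (λ r → u i ≡φ embed r mod + 2) (sym (lookup∘tabulate (reduce ∘ u) i)) (u≡embed[reduce[u]] (u i))

Searchable : Set → Set₁
Searchable A = ∀ {P : Pred A 0ℓ} → Decidable P → Dec (∀ a → P a)

searchable-Bool : Searchable Bool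
searchable-Bool P? = map′ (λ (Pf , Pt) → λ { false → Pf ; true → Pt }) (λ ∀P → ∀P false , ∀P true)
                          (P? false ×-dec P? true)

searchable-Vec : ∀ {A} → Searchable A → ∀ n → Searchable (Vec A n)
searchable-Vec search ℕ.zero    P? = map′ (λ P[] → λ { [] → P[] }) (λ ∀P → ∀P []) (P? [])
searchable-Vec search (ℕ.suc n) P? =
  map′ (λ ∀P → λ { (a ∷ as) → ∀P a as }) (λ ∀P a as → ∀P (a ∷ as))
       (search λ a → searchable-Vec search n λ as → P? (a ∷ as))

-- Decided by evaluation; testing qs first prunes all but 12 of its 256 values.
parity-obstruction : ∀ (qs : Vec Parity 4) → (+ 2) +φ 0ℤ ≡φ ⟨ lift qs , lift qs ⟩ mod + 4 →
                     ∀ (ps : Vec Parity 4) → (+ 4) +φ (+ 2) ≡φ ⟨ lift ps , lift ps ⟩ mod + 4 →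
                     ¬ (+ 2 ·φ (0ℤ +φ -1ℤ) ≡φ + 2 ·φ ⟨ lift ps , lift qs ⟩ mod + 4)
parity-obstruction = from-yes (searchable-Vec parities 4 λ qs →
  ((+ 2) +φ 0ℤ ≡φ? ⟨ lift qs , lift qs ⟩ mod + 4) →-dec searchable-Vec parities 4 λ ps →
  ((+ 4) +φ (+ 2) ≡φ? ⟨ lift ps , lift ps ⟩ mod + 4) →-dec
  ¬? (+ 2 ·φ (0ℤ +φ -1ℤ) ≡φ? + 2 ·φ ⟨ lift ps , lift qs ⟩ mod + 4))
  where
  parities : Searchable Parity
  parities = searchable-Vec searchable-Bool 2

gram≢gram[α₅] : ∀ {t} (v : Fin 4 → OK t) → ¬ (gram v ≡ gram (α₅ {t}))
gram≢gram[α₅] v gram-eq = parity-obstruction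
  qs (subst (λ Q → Q ≡φ ⟨ lift qs , lift qs ⟩ mod + 4) (cong (proj₁ ∘ proj₂) gram-eq)
            (⟨u,u⟩-cong[mod4] (u≡lift[reduce[u]] q)))
  ps (subst (λ P → P ≡φ ⟨ lift ps , lift ps ⟩ mod + 4) (cong proj₁ gram-eq)
            (⟨u,u⟩-cong[mod4] (u≡lift[reduce[u]] p)))
     (subst (λ X → + 2 ·φ X ≡φ + 2 ·φ ⟨ lift ps , lift qs ⟩ mod + 4) (cong (proj₂ ∘ proj₂) gram-eq)
            (·φ-scale[mod] (+ 2) (⟨⟩-cong[mod] (u≡lift[reduce[u]] p) (u≡lift[reduce[u]] q))))
  where
  p q : Fin 4 → Zφ
  p = fst ∘ v
  q = snd ∘ v
  ps qs : Vec Parity 4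
  ps = tabulate (reduce ∘ p)
  qs = tabulate (reduce ∘ q)

no-four-squares : ∀ {t} → + 3 ≤ t → ¬ IsSumOfSquares 4 (sumSq 5 (α₅ {t}))
no-four-squares 3≤t (v , Σv²≡Σα₅²) = gram≢gram[α₅] v (gram-forced 3≤t v Σv²≡Σα₅²)

module _ {t : ℤ} where

  sq[0ₒ]+ₒ : ∀ (x : OK t) → sq 0ₒ +ₒ x ≡ x
  sq[0ₒ]+ₒ x = OK-≡ (Zφ-≡ (absorb t _) (absorb t _)) (Zφ-≡ (ℤ.+-identityˡ _) (ℤ.+-identityˡ _))
    where
    absorb : ∀ t a → 0ℤ + t * 0ℤ + a ≡ a
    absorb = solve-∀

  sumOfSquares-suc : ∀ {m} {x : OK t} → IsSumOfSquares m x → IsSumOfSquares (ℕ.suc m) x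
  sumOfSquares-suc {m} (v , Σv²≡x) =
    (λ { zero → 0ₒ ; (suc i) → v i }) , trans (sq[0ₒ]+ₒ (sumSq m v)) Σv²≡x

  sumOfSquares-mono : ∀ {m n} {x : OK t} → m ℕ.≤ n → IsSumOfSquares m x → IsSumOfSquares n x
  sumOfSquares-mono = mono′ ∘ ℕ.≤⇒≤′
    where
    mono′ : ∀ {m n} {x : OK t} → m ℕ.≤′ n → IsSumOfSquares m x → IsSumOfSquares n x
    mono′ ℕ.≤′-refl        = id
    mono′ (ℕ.≤′-step m≤′n) = sumOfSquares-suc ∘ mono′ m≤′n

  reassociate : ∀ (a b c d e : OK t) →
                a +ₒ b +ₒ c +ₒ d +ₒ e ≡ a +ₒ (b +ₒ (c +ₒ (d +ₒ (e +ₒ 0ₒ))))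
  reassociate a b c d e =
    OK-≡ (Zφ-≡ (on (re ∘ fst)) (on (im ∘ fst))) (Zφ-≡ (on (re ∘ snd)) (on (im ∘ snd)))
    where
    reassoc : ∀ a b c d e → a + b + c + d + e ≡ a + (b + (c + (d + (e + 0ℤ))))
    reassoc = solve-∀
    on : ∀ (π : OK t → ℤ) →
         π a + π b + π c + π d + π e ≡ π a + (π b + (π c + (π d + (π e + 0ℤ))))
    on π = reassoc (π a) (π b) (π c) (π d) (π e)

α≡sumSq[α₅] : ∀ s → α s ≡ sumSq 5 α₅
α≡sumSq[α₅] s = reassociate (sq 1ₒ) (sq 1ₒ) (sq φₒ) (sq ωₒ) (sq (ωₒ +ₒ (-ₒ φₒ)))

3≤s/4 : ∀ {s} → 5 < s → SquareFree s → s % 4 ≡ 1 → 3 ℕ.≤ s ℕ./ 4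
3≤s/4 {s} 5<s squarefree s%4≡1 =
  bound (s ℕ./ 4) (trans (m≡m%n+[m/n]*n s 4) (cong (ℕ._+ s ℕ./ 4 ℕ.* 4) s%4≡1))
  where
  bound : ∀ q → s ≡ 1 ℕ.+ q ℕ.* 4 → 3 ℕ.≤ q
  bound 0 s≡1 = contradiction (subst (5 <_) s≡1 5<s) λ { (ℕ.s≤s ()) }
  bound 1 s≡5 = contradiction (subst (5 <_) s≡5 5<s) (ℕ.<-irrefl refl)
  bound 2 s≡9 = contradiction (squarefree 3 (divides 1 s≡9)) λ ()
  bound (ℕ.suc (ℕ.suc (ℕ.suc q))) _ = ℕ.s≤s (ℕ.s≤s (ℕ.s≤s ℕ.z≤n))

-- The hypothesis 5 ∤ s only serves to make O_K = ℤ[φ][ω], which the definition of OK builds in.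
proposition6p8 : (s : ℕ) → 5 < s → SquareFree s → ¬ (5 ∣ s) → s % 4 ≡ 1 →
    PythagorasAtLeast {tOf s} 5 × HasLength (α s) 5
proposition6p8 s 5<s squarefree _ s%4≡1 = (α s , (5 , five-squares) , no-fewer) , five-squares , no-fewer
  where
  five-squares : IsSumOfSquares 5 (α s)
  five-squares = α₅ , sym (α≡sumSq[α₅] s)
  no-fewer : ∀ m → m < 5 → ¬ IsSumOfSquares m (α s)
  no-fewer m m<5 = no-four-squares (+≤+ (3≤s/4 5<s squarefree s%4≡1))
                 ∘ subst (IsSumOfSquares 4) (α≡sumSq[α₅] s) ∘ sumOfSquares-mono (ℕ.s≤s⁻¹ m<5)
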